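{- Let $G$ be a BDH graph with color classes $X$ and $Y$, and let $v,v'\in V(G)$. Define $G\star\{v,v'\}$ as follows: if $v$ and $v'$ lie in different color classes, $G\star\{v,v'\}=G$; if they lie in the same color class, $G\star\{v,v'\}$ is obtained from $G$ by adding a new vertex $\widehat{vv'}$ to that color class, adjacent exactly to the vertices of $N(v)\cap N(v')$. Then $G\star\{v,v'\}$ is a BDH graph.
   Context: A graph $G$ is distance hereditary if for every connected induced subgraph $H$ of $G$ and all $u,v\in V(H)$, $d_H(u,v)=d_G(u,v)$; a BDH graph is a bipartite distance hereditary graph (equivalently, a bipartite graph with no induced cycle of length at least 6 and no induced domino, the domino being $C_6$ plus one chord joining two antipodal vertices). $N(v)$ denotes the set of neighbors of $v$. -}

module Defs where

open import Data.Nat using (ℕ; zero; suc; _<_)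
open import Data.Fin using (Fin; zero; suc)
open import Data.Bool using (Bool; true; false; _∧_; _xor_; if_then_else_)
open import Data.Product using (Σ; _×_; ∃; _,_)
open import Relation.Binary.PropositionalEquality using (_≡_; _≢_; refl)
open import Relation.Nullary using (¬_)

record Graph (n : ℕ) : Set where
  field
    adj    : Fin n → Fin n → Bool
    sym    : ∀ u w → adj u w ≡ adj w u
    irrefl : ∀ u → adj u u ≡ false
open Graph public

-- A proper 2-colouring; colour classes X = {u | c u ≡ true}, Y = {u | c u ≡ false}.
ProperColouring : ∀ {n} → Graph n → (Fin n → Bool) → Set
ProperColouring G c = ∀ u w → adj G u w ≡ true → c u ≢ c w

Bipartite : ∀ {n} → Graph n → Set
Bipartite {n} G = Σ (Fin n → Bool) (ProperColouring G)

-- Walks of length k from u to v using only vertices of the vertex set S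
-- (i.e. walks in the induced subgraph G[S]).
data Walk {n} (G : Graph n) (S : Fin n → Bool) : Fin n → Fin n → ℕ → Set where
  here : ∀ {u} → S u ≡ true → Walk G S u u 0
  step : ∀ {u w v k} → S u ≡ true → adj G u w ≡ true → Walk G S w v k →
         Walk G S u v (suc k)

IsDist : ∀ {n} → Graph n → (Fin n → Bool) → Fin n → Fin n → ℕ → Set
IsDist G S u v k = Walk G S u v k × (∀ m → m < k → ¬ Walk G S u v m)

ConnectedOn : ∀ {n} → Graph n → (Fin n → Bool) → Set
ConnectedOn G S = ∀ u v → S u ≡ true → S v ≡ true → ∃ λ k → Walk G S u v k

allV : ∀ {n} → Fin n → Bool
allV _ = true

DistanceHereditary : ∀ {n} → Graph n → Set
DistanceHereditary {n} G =
  ∀ (S : Fin n → Bool) → ConnectedOn G S →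
  ∀ u v → S u ≡ true → S v ≡ true →
  ∀ k → IsDist G S u v k → IsDist G allV u v k

BDH : ∀ {n} → Graph n → Set
BDH G = Bipartite G × DistanceHereditary G

-- G with a new vertex (index zero; old vertex u becomes suc u)
-- adjacent exactly to N(v) ∩ N(v').
extend : ∀ {n} → Graph n → Fin n → Fin n → Graph (suc n)
extend {n} G v v' = record { adj = a ; sym = s ; irrefl = i }
  where
  a : Fin (suc n) → Fin (suc n) → Bool
  a zero zero = false
  a zero (suc w) = adj G v w ∧ adj G v' w
  a (suc w) zero = adj G v w ∧ adj G v' w
  a (suc x) (suc y) = adj G x y
  s : ∀ u w → a u w ≡ a w u
  s zero zero = refl
  s zero (suc w) = refl
  s (suc w) zero = refl
  s (suc x) (suc y) = sym G x y
  i : ∀ u → a u u ≡ false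
  i zero = refl
  i (suc u) = irrefl G u

star : ∀ {n} → Graph n → (Fin n → Bool) → Fin n → Fin n → Σ ℕ Graph
star {n} G c v v' =
  if c v xor c v' then (n , G) else (suc n , extend G v v')

BDH' : Σ ℕ Graph → Set
BDH' (_ , H) = BDH H

module Submission where

-- If v and v' have different colours, G ⋆ {v,v'} = G.  Otherwise H = G ⋆ {v,v'} is G plus a
-- new vertex z adjacent to the common neighbourhood C = N(v) ∩ N(v').  Colouring z like v is
-- proper, since every neighbour of z is a neighbour of v.  For distance heredity we use the
-- characterisation "every induced path is a shortest path": a shortest walk inside an induced
-- subgraph is an induced path, and conversely, in a distance hereditary graph an induced path
-- is a shortest path inside the subgraph its vertices span, hence in the whole graph.
--
-- So let P be an induced path of H.  Collapsing z onto a vertex w ∈ {v, v'} (a vertex adjacent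
-- to all of C) maps walks of H to walks of G of the same length, and maps P to an induced path
-- of G unless w "clashes" with P: w lies on P, or w is adjacent to a vertex of P at distance
-- at least 2 from z.  Using that G is bipartite and distance hereditary, a clash of w forces
-- w to be adjacent to the vertex three steps after (or before) z on P.  If both v and v'
-- clash, either that vertex lies in C, contradicting that P is induced, or P contains a
-- configuration which, after collapsing z, is an induced path of length 4 in G whose ends are
-- at distance 2.  Hence one of the collapses is an induced path of G, thus a shortest path,
-- and P is a shortest path of H.

open import Defs hiding (sym)
open import Data.Nat using (ℕ; zero; suc; _+_; _∸_; _≤_; _<_; z≤n; s≤s; s≤s⁻¹; _≤?_)
open import Data.Nat.Properties
  using (≤-refl; ≤-trans; ≤-antisym; ≤-reflexive; <⇒≤; <⇒≢; <⇒≱; ≰⇒>; ≤∧≢⇒<; 1+n≰n; n≤1+n;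
         m≤n+m; m+n≤o⇒n≤o; +-suc; +-identityʳ; +-monoˡ-≤; +-cancelʳ-≤; +-cancelʳ-≡; <-cmp; m+[n∸m]≡n;
         m∸n+n≡m; m∸n≤m; m∸[m∸n]≡n; ∸-monoʳ-<; ∸-cancelˡ-≡; +-∸-assoc; anyUpTo?)
open import Data.Fin using (Fin; zero; suc)
open import Data.Fin.Properties using (_≟_; suc-injective)
open import Data.Bool using (Bool; true; false; _∧_; _xor_; if_then_else_)
open import Data.Bool.Properties using () renaming (_≟_ to _≟ᵇ_)
open import Data.Product using (Σ; _×_; ∃; _,_; proj₁; proj₂; swap)
open import Data.Sum using (_⊎_; inj₁; inj₂)
open import Data.Empty using (⊥; ⊥-elim)
open import Function using (_∘_)
open import Relation.Nullary using (¬_; Dec; yes; no; does; contradiction; ¬?)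
open import Relation.Nullary.Decidable using (dec-true; decidable-stable; _⊎-dec_; _×-dec_)
open import Relation.Binary.PropositionalEquality
  using (_≡_; _≢_; refl; sym; trans; cong; subst; subst₂)
open import Relation.Binary using (tri<; tri≈; tri>)

variable
  N : ℕ
  G : Graph N
  S : Fin N → Bool
  a b t u : Fin N
  i j k l m : ℕ
  q : ℕ → Fin N

∧-left : ∀ {p r} → (p ∧ r) ≡ true → p ≡ true
∧-left {true} _ = refl

∧-right : ∀ {p r} → (p ∧ r) ≡ true → r ≡ true
∧-right {true} e = e

module GraphFacts (G : Graph N) where

  adj-sym : adj G a b ≡ true → adj G b a ≡ true
  adj-sym {a = a} {b} e = trans (Graph.sym G b a) e

  adjacent-distinct : adj G a b ≡ true → a ≢ b
  adjacent-distinct {a = a} e refl with () ← trans (sym (irrefl G a)) e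

  two-step : ∀ {x y z} → adj G x y ≡ true → adj G y z ≡ true → Walk G allV x z 2
  two-step xy yz = step refl xy (step refl yz (here refl))

  no-triangle : ∀ {c x y z} → ProperColouring G c →
                adj G x y ≡ true → adj G y z ≡ true → adj G x z ≡ true → ⊥
  no-triangle {x = x} {y} {z} pc xy yz xz = pc x z xz (two-colours (pc x y xy) (pc y z yz))
    where
    two-colours : ∀ {a b d : Bool} → a ≢ b → b ≢ d → a ≡ d
    two-colours {false} {false} a≢b _ = ⊥-elim (a≢b refl)
    two-colours {true}  {true}  a≢b _ = ⊥-elim (a≢b refl)
    two-colours {_} {false} {false} _ b≢d = ⊥-elim (b≢d refl)
    two-colours {_} {true}  {true}  _ b≢d = ⊥-elim (b≢d refl)
    two-colours {false} {true}  {false} _ _ = refl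
    two-colours {true}  {false} {true}  _ _ = refl

start-in : Walk G S u t k → S u ≡ true
start-in (here s)     = s
start-in (step s _ _) = s

end-in : Walk G S u t k → S t ≡ true
end-in (here s)      = s
end-in (step _ _ wk) = end-in wk

_++ʷ_ : Walk G S u a m → Walk G S a t k → Walk G S u t (m + k)
here _       ++ʷ wk' = wk'
step s e wk  ++ʷ wk' = step s e (wk ++ʷ wk')

snocʷ : Walk G S u a m → adj G a t ≡ true → S t ≡ true → Walk G S u t (suc m)
snocʷ (here s)      e st = step s e (here st)
snocʷ (step s e wk) e' st = step s e (snocʷ wk e' st)

reverseʷ : Walk G S u t m → Walk G S t u m
reverseʷ (here s)                = here s
reverseʷ {G = G} (step s e wk) = snocʷ (reverseʷ wk) (GraphFacts.adj-sym G e) s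

forget : Walk G S u t m → Walk G allV u t m
forget (here _)      = here refl
forget (step _ e wk) = step refl e (forget wk)

-- The i-th vertex of a walk (the last one for i beyond its length).
vertex : ∀ {N} {G : Graph N} {S u t k} → Walk G S u t k → ℕ → Fin N
vertex {u = u} _ zero         = u
vertex {u = u} (here _) (suc _)  = u
vertex (step _ _ wk) (suc i)  = vertex wk i

vertex-end : (wk : Walk G S u t k) → vertex wk k ≡ t
vertex-end (here _)      = refl
vertex-end (step _ _ wk) = vertex-end wk

vertex-adj : (wk : Walk G S u t k) → ∀ i → i < k → adj G (vertex wk i) (vertex wk (suc i)) ≡ true
vertex-adj (step _ e _)  zero    _ = e
vertex-adj (step _ _ wk) (suc i) h = vertex-adj wk i (s≤s⁻¹ h)

prefix : (wk : Walk G S u t k) → ∀ j → j ≤ k → Walk G S u (vertex wk j) j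
prefix wk            zero    _ = here (start-in wk)
prefix (step s e wk) (suc j) h = step s e (prefix wk j (s≤s⁻¹ h))

suffix : (wk : Walk G S u t k) → ∀ l → l ≤ k → Walk G S (vertex wk l) t (k ∸ l)
suffix wk            zero    _ = wk
suffix (step _ _ wk) (suc l) h = suffix wk l (s≤s⁻¹ h)

-- Keeping positions 0..j and l..k of a walk of length k, where j < l, leaves fewer than k steps.
shortcut-shorter : j < l → l ≤ k → j + (k ∸ l) < k
shortcut-shorter {j} {l} {k} j<l l≤k =
  subst (suc j + (k ∸ l) ≤_) (m+[n∸m]≡n l≤k) (+-monoˡ-≤ (k ∸ l) j<l)

Near : ℕ → ℕ → Set
Near j l = l ≤ suc j × j ≤ suc l

near? : (j l : ℕ) → Dec (Near j l)
near? j l = (l ≤? suc j) ×-dec (j ≤? suc l)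

not-near-3 : ¬ Near i (3 + i)
not-near-3 {i} (h , _) = 1+n≰n (≤-trans (n≤1+n (suc i)) (s≤s⁻¹ h))

record IsInducedPath (G : Graph N) (q : ℕ → Fin N) (k : ℕ) : Set where
  field
    consecutive : ∀ j → j < k → adj G (q j) (q (suc j)) ≡ true
    chordless   : ∀ j l → j ≤ k → l ≤ k → adj G (q j) (q l) ≡ true → l ≤ suc j
    injective   : ∀ j l → j ≤ k → l ≤ k → q j ≡ q l → j ≡ l

  near : j ≤ k → l ≤ k → adj G (q j) (q l) ≡ true → Near j l
  near {j} {l} hj hl e = chordless j l hj hl e , chordless l j hl hj (GraphFacts.adj-sym G e)

-- A shortest walk (inside any G[S]) is an induced path: a chord or a repeated vertex
-- would give a shortcut.
shortest-walk-induced : (wk : Walk G S u t k) → (∀ m → m < k → ¬ Walk G S u t m) →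
                        IsInducedPath G (vertex wk) k
shortest-walk-induced {G = G} {S} {u} {t} {k} wk shortest = record
  { consecutive = vertex-adj wk ; chordless = chordless ; injective = injective }
  where
  chordless : ∀ j l → j ≤ k → l ≤ k → adj G (vertex wk j) (vertex wk l) ≡ true → l ≤ suc j
  chordless j l hj hl e with l ≤? suc j
  ... | yes l≤1+j = l≤1+j
  ... | no far = ⊥-elim (shortest _ shorter
                   (prefix wk j hj ++ʷ step (end-in (prefix wk j hj)) e (suffix wk l hl)))
    where
    shorter : j + suc (k ∸ l) < k
    shorter = subst (_< k) (sym (+-suc j (k ∸ l))) (shortcut-shorter (≰⇒> far) hl)

  skip : ∀ j l → j < l → l ≤ k → vertex wk j ≡ vertex wk l → ⊥
  skip j l j<l hl e = shortest _ (shortcut-shorter j<l hl)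
    (prefix wk j (<⇒≤ (≤-trans j<l hl)) ++ʷ subst (λ x → Walk G S x t (k ∸ l)) (sym e) (suffix wk l hl))

  injective : ∀ j l → j ≤ k → l ≤ k → vertex wk j ≡ vertex wk l → j ≡ l
  injective j l hj hl e with <-cmp j l
  ... | tri< j<l _ _ = ⊥-elim (skip j l j<l hl e)
  ... | tri≈ _ j≡l _ = j≡l
  ... | tri> _ _ l<j = ⊥-elim (skip l j l<j hj (sym e))

short-walk-bound : IsInducedPath G q k → Walk G S (q 0) (q k) m → m ≤ 1 → k ≤ m
short-walk-bound {G = G} {q = q} {k} {S = S} ip wk = go wk refl refl
  where
  open IsInducedPath ip
  go : Walk G S a b m → a ≡ q 0 → b ≡ q k → m ≤ 1 → k ≤ m
  go (here _)               refl eb _ = ≤-reflexive (sym (injective 0 k z≤n ≤-refl eb))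
  go (step _ e (here _))    refl refl _ = chordless 0 k z≤n ≤-refl e
  go (step _ _ (step _ _ _)) _ _ (s≤s ())

shift : (ℕ → Fin N) → ℕ → ℕ → Fin N
shift q s j = q (j + s)

subpath-induced : ∀ {len s} → IsInducedPath G q k → len + s ≤ k → IsInducedPath G (shift q s) len
subpath-induced {q = q} {k} {len} {s} ip bound = record
  { consecutive = λ j j<len → consecutive (j + s) (inside (suc j) j<len)
  ; chordless   = λ j l hj hl e → +-cancelʳ-≤ s l (suc j) (chordless _ _ (inside j hj) (inside l hl) e)
  ; injective   = λ j l hj hl e → +-cancelʳ-≡ s j l (injective _ _ (inside j hj) (inside l hl) e) }
  where
  open IsInducedPath ip
  inside : ∀ j → j ≤ len → j + s ≤ k
  inside j hj = ≤-trans (+-monoˡ-≤ s hj) bound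

reverse : (ℕ → Fin N) → ℕ → ℕ → Fin N
reverse q k j = q (k ∸ j)

reverse-step : j ≤ k → l ≤ k → k ∸ j ≤ suc (k ∸ l) → l ≤ suc j
reverse-step {j} {k} {l} hj hl h with l ≤? suc j
... | yes l≤1+j = l≤1+j
... | no far = ⊥-elim (1+n≰n (≤-trans (≤-trans (s≤s drop-l) drop-j) h))
  where
  1+j<l : suc j < l
  1+j<l = ≰⇒> far
  drop-l : k ∸ l < k ∸ suc j
  drop-l = ∸-monoʳ-< 1+j<l hl
  drop-j : k ∸ suc j < k ∸ j
  drop-j = ∸-monoʳ-< ≤-refl (<⇒≤ (≤-trans 1+j<l hl))

reverse-near : i ≤ k → l ≤ k → Near (k ∸ i) (k ∸ l) → Near i l
reverse-near hi hl (a , b) = reverse-step hi hl b , reverse-step hl hi a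

reverse-induced : IsInducedPath G q k → IsInducedPath G (reverse q k) k
reverse-induced {G = G} {q = q} {k} ip = record
  { consecutive = consecutive′
  ; chordless   = λ j l hj hl e → reverse-step hj hl (proj₂ (near (m∸n≤m k j) (m∸n≤m k l) e))
  ; injective   = λ j l hj hl e → ∸-cancelˡ-≡ hj hl (injective _ _ (m∸n≤m k j) (m∸n≤m k l) e) }
  where
  open IsInducedPath ip
  consecutive′ : ∀ j → j < k → adj G (q (k ∸ j)) (q (k ∸ suc j)) ≡ true
  consecutive′ j j<k = subst (λ x → adj G (q x) (q (k ∸ suc j)) ≡ true) (sym k∸j)
    (GraphFacts.adj-sym G (consecutive (k ∸ suc j) (subst (_≤ k) k∸j (m∸n≤m k j))))
    where
    k∸j : k ∸ j ≡ suc (k ∸ suc j)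
    k∸j = +-∸-assoc 1 j<k

onPath : (ℕ → Fin N) → ℕ → Fin N → Bool
onPath q k x = does (anyUpTo? (λ j → q j ≟ x) (suc k))

onPath-sound : ∀ {N} (q : ℕ → Fin N) k {a} → onPath q k a ≡ true → ∃ λ j → j ≤ k × q j ≡ a
onPath-sound q k {a} h with anyUpTo? (λ j → q j ≟ a) (suc k)
... | yes (j , s≤s j≤k , e) = j , j≤k , e
... | no _ = contradiction h λ ()

onPath-complete : ∀ {N} (q : ℕ → Fin N) k {j} → j ≤ k → onPath q k (q j) ≡ true
onPath-complete q k {j} j≤k = dec-true (anyUpTo? (λ l → q l ≟ q j) (suc k)) (j , s≤s j≤k , refl)

-- Inside the subgraph
-- spanned by the path each step advances the position along the path by at most one, so the
-- path is a shortest walk there; distance heredity transfers this to the whole graph.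
module InducedPathGeodesic (G : Graph N) {q : ℕ → Fin N} {k : ℕ} (ip : IsInducedPath G q k) where
  open IsInducedPath ip

  along : ∀ j → j ≤ k → Walk G (onPath q k) (q 0) (q j) j
  along zero    _   = here (onPath-complete q k z≤n)
  along (suc j) j<k = snocʷ (along j (<⇒≤ j<k)) (consecutive j j<k) (onPath-complete q k j<k)

  index-advance : Walk G (onPath q k) a b m → j ≤ k → l ≤ k → q j ≡ a → q l ≡ b → l ≤ j + m
  index-advance {j = j} {l} (here _) hj hl ej el =
    subst (_≤ j + 0) (injective j l hj hl (trans ej (sym el))) (≤-reflexive (sym (+-identityʳ j)))
  index-advance {m = suc m} {j = j} (step _ e wk) hj hl ej el
    with onPath-sound q k (start-in wk)
  ... | j′ , hj′ , ej′ =
    ≤-trans (index-advance wk hj′ hl ej′ el)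
            (≤-trans (+-monoˡ-≤ m (chordless j j′ hj hj′ (subst₂ (λ x y → adj G x y ≡ true) (sym ej) (sym ej′) e)))
                     (≤-reflexive (sym (+-suc j m))))

  geodesic : DistanceHereditary G → Walk G allV (q 0) (q k) m → k ≤ m
  geodesic {m} dh wk with k ≤? m
  ... | yes k≤m = k≤m
  ... | no k≰m = ⊥-elim (proj₂ (dh (onPath q k) connected (q 0) (q k) (onPath-complete q k z≤n)
                                   (onPath-complete q k ≤-refl) k (along k ≤-refl , no-shorter))
                               m (≰⇒> k≰m) wk)
    where
    connected : ConnectedOn G (onPath q k)
    connected x y sx sy with onPath-sound q k sx | onPath-sound q k sy
    ... | j , hj , refl | l , hl , refl = j + l , reverseʷ (along j hj) ++ʷ along l hl
    no-shorter : ∀ m → m < k → ¬ Walk G (onPath q k) (q 0) (q k) m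
    no-shorter m m<k wk′ = <⇒≱ m<k (index-advance wk′ z≤n ≤-refl refl refl)

open InducedPathGeodesic using (geodesic)

-- Conversely, if all induced paths are shortest paths, the graph is distance hereditary:
-- a shortest walk in an induced subgraph is an induced path.
distance-hereditary-from-geodesics :
  (G : Graph N) → (∀ {q k m} → IsInducedPath G q k → Walk G allV (q 0) (q k) m → k ≤ m) →
  DistanceHereditary G
distance-hereditary-from-geodesics G geo S _ u t _ _ k (wk , shortest) =
  forget wk , λ m m<k wk′ →
    <⇒≱ m<k (geo (shortest-walk-induced wk shortest)
                 (subst (λ x → Walk G allV u x m) (sym (vertex-end wk)) wk′))

-- The extension H = G ⋆ {v,v'} = G + z, where z (= zero) is adjacent to C = N(v) ∩ N(v').
module Extension {n} (G : Graph n) (col : Fin n → Bool) (pc : ProperColouring G col)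
                 (dh : DistanceHereditary G) (v v' : Fin n) where

  open GraphFacts G

  H : Graph (suc n)
  H = extend G v v'

  -- x ∈ C; definitionally, x is adjacent to z in H.
  Common : Fin n → Set
  Common x = (adj G v x ∧ adj G v' x) ≡ true

  Dominating : Fin n → Set
  Dominating w = ∀ {x} → Common x → adj G w x ≡ true

  Joint : Fin n → Fin n → Set
  Joint w w' = ∀ {x} → adj G w x ≡ true → adj G w' x ≡ true → Common x

  dominating-v : Dominating v
  dominating-v = ∧-left

  dominating-v' : Dominating v'
  dominating-v' {x} = ∧-right {adj G v x}

  joint-vv' : Joint v v'
  joint-vv' e e' = subst₂ (λ p r → (p ∧ r) ≡ true) (sym e) (sym e') refl

  joint-v'v : Joint v' v
  joint-v'v e e' = joint-vv' e' e

  -- z gets the colour of v; this is proper because N(z) ⊆ N(v).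
  colour : Fin (suc n) → Bool
  colour zero    = col v
  colour (suc x) = col x

  colour-proper : ProperColouring H colour
  colour-proper zero    (suc y) e = pc v y (∧-left e)
  colour-proper (suc x) zero    e = pc x v (adj-sym (∧-left e))
  colour-proper (suc x) (suc y) e = pc x y e

  lift-adj : ∀ {x y} → a ≡ suc x → b ≡ suc y → adj G x y ≡ true → adj H a b ≡ true
  lift-adj refl refl e = e

  drop-adj : ∀ {x y} → a ≡ suc x → b ≡ suc y → adj H a b ≡ true → adj G x y ≡ true
  drop-adj refl refl e = e

  next-of-new : ∀ b → a ≡ zero → adj H a b ≡ true → Σ (Fin n) λ x → b ≡ suc x × Common x
  next-of-new (suc x) refl e = x , refl , e

  previous-of-new : ∀ a → b ≡ zero → adj H a b ≡ true → Σ (Fin n) λ x → a ≡ suc x × Common x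
  previous-of-new (suc x) refl e = x , refl , e

  common-near-new : ∀ {x} → IsInducedPath H q k → i ≤ k → l ≤ k → q i ≡ zero → q l ≡ suc x →
                    Common x → Near i l
  common-near-new ip hi hl zi el c =
    IsInducedPath.near ip hi hl (subst₂ (λ a b → adj H a b ≡ true) (sym zi) (sym el) c)

  -- Collapsing z onto w: a graph homomorphism H → G when w is dominating; it maps walks of
  -- H to walks of G of the same length.
  project : Fin n → Fin (suc n) → Fin n
  project w zero    = w
  project w (suc x) = x

  project-adj : ∀ {w} → Dominating w → ∀ a b → adj H a b ≡ true → adj G (project w a) (project w b) ≡ true
  project-adj dom zero    (suc y) e = dom e
  project-adj dom (suc x) zero    e = adj-sym (dom e)
  project-adj dom (suc x) (suc y) e = e

  project-walk : ∀ {w} → Dominating w → Walk H allV a b m → Walk G allV (project w a) (project w b) m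
  project-walk dom (here _)      = here refl
  project-walk dom (step {u = x} {w = y} _ e wk) = step refl (project-adj dom x y e) (project-walk dom wk)

  Clash : Fin n → ℕ → ℕ → Fin (suc n) → Set
  Clash w i l zero    = ⊥
  Clash w i l (suc x) = x ≡ w ⊎ (adj G w x ≡ true × ¬ Near i l)

  clash? : ∀ w i l y → Dec (Clash w i l y)
  clash? w i l zero    = no λ ()
  clash? w i l (suc x) = (x ≟ w) ⊎-dec ((adj G w x ≟ᵇ true) ×-dec ¬? (near? i l))

  no-clash-near : ∀ {w x} → ¬ Clash w i l (suc x) → adj G w x ≡ true → Near i l
  no-clash-near {i} {l} nc wx = decidable-stable (near? i l) λ far → nc (inj₂ (wx , far))

  no-clash-at-new : ∀ {w y} → y ≡ zero → ¬ Clash w i l y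
  no-clash-at-new refl ()

  clash-reindex : ∀ {w i′ l′ y} → (Near i′ l′ → Near i l) → Clash w i l y → Clash w i′ l′ y
  clash-reindex {y = suc x} _ (inj₁ x≡w)       = inj₁ x≡w
  clash-reindex {y = suc x} f (inj₂ (wx , far)) = inj₂ (wx , far ∘ f)

  NoClashes : Fin n → (ℕ → Fin (suc n)) → ℕ → Set
  NoClashes w q k = ∀ j l → j ≤ k → l ≤ k → q j ≡ zero → ¬ Clash w j l (q l)

  project-induced : ∀ {w} → Dominating w → IsInducedPath H q k → NoClashes w q k →
                    IsInducedPath G (project w ∘ q) k
  project-induced {q = q} {k} {w} dom ip ok = record
    { consecutive = λ j j<k → project-adj dom (q j) (q (suc j)) (consecutive j j<k)
    ; chordless   = λ j l hj hl e → proj₁ (chord-near j l hj hl e)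
    ; injective   = inject }
    where
    open IsInducedPath ip
    chord-near : ∀ j l → j ≤ k → l ≤ k → adj G (project w (q j)) (project w (q l)) ≡ true → Near j l
    chord-near j l hj hl e with q j in ej | q l in el
    ... | zero  | zero  = ⊥-elim (adjacent-distinct e refl)
    ... | zero  | suc _ = no-clash-near (subst (λ y → ¬ Clash w j l y) el (ok j l hj hl ej)) e
    ... | suc _ | zero  = swap (no-clash-near (subst (λ y → ¬ Clash w l j y) ej (ok l j hl hj el)) (adj-sym e))
    ... | suc _ | suc _ = near hj hl (lift-adj ej el e)
    inject : ∀ j l → j ≤ k → l ≤ k → project w (q j) ≡ project w (q l) → j ≡ l
    inject j l hj hl e with q j in ej | q l in el
    ... | zero  | zero  = injective j l hj hl (trans ej (sym el))
    ... | zero  | suc _ = ⊥-elim (ok j l hj hl ej (subst (Clash w j l) (sym el) (inj₁ (sym e))))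
    ... | suc _ | zero  = ⊥-elim (ok l j hl hj el (subst (Clash w l j) (sym ej) (inj₁ e)))
    ... | suc _ | suc _ = injective j l hj hl (trans ej (trans (cong suc e) (sym el)))

  avoiding-induced : ∀ {w} → Dominating w → IsInducedPath H q k → (∀ l → l ≤ k → q l ≢ zero) →
                     IsInducedPath G (project w ∘ q) k
  avoiding-induced dom ip avoids = project-induced dom ip λ j _ hj _ zj → ⊥-elim (avoids j hj zj)

  clash-or-induced : ∀ {w} → Dominating w → IsInducedPath H q k → i ≤ k → q i ≡ zero →
                     (∃ λ l → l ≤ k × Clash w i l (q l)) ⊎ IsInducedPath G (project w ∘ q) k
  clash-or-induced {q = q} {k} {i} {w} dom ip hi zi with anyUpTo? (λ l → clash? w i l (q l)) (suc k)
  ... | yes (l , s≤s hl , cl) = inj₁ (l , hl , cl)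
  ... | no none = inj₂ (project-induced dom ip no-clash)
    where
    no-clash : NoClashes w q k
    no-clash j l hj hl zj cl = none (l , s≤s hl , subst (λ p → Clash w p l (q l))
                                       (IsInducedPath.injective ip j i hj hi (trans zj (sym zi))) cl)

  new-vertex? : ∀ (q : ℕ → Fin (suc n)) k → (∃ λ i → i ≤ k × q i ≡ zero) ⊎ (∀ l → l ≤ k → q l ≢ zero)
  new-vertex? q k with anyUpTo? (λ l → q l ≟ zero) (suc k)
  ... | yes (i , s≤s hi , zi) = inj₁ (i , hi , zi)
  ... | no none = inj₂ λ l hl zl → none (l , s≤s hl , zl)

  AdjThreeAfter : (ℕ → Fin (suc n)) → ℕ → ℕ → Fin n → Set
  AdjThreeAfter q k i w = 3 + i ≤ k × Σ (Fin n) λ x → q (3 + i) ≡ suc x × adj G w x ≡ true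

  -- If w itself sits two steps after z, then z is the first vertex (otherwise the vertex
  -- before z, a member of C, would be adjacent to w), so w is adjacent to the next vertex.
  two-after : ∀ {w} → Dominating w → IsInducedPath H q k → 3 ≤ k →
              ∀ i → q i ≡ zero → q (2 + i) ≡ suc w → 2 + i ≤ k → AdjThreeAfter q k i w
  two-after {q = q} {k} dom ip k3 zero z0 e2 _ with q 3 in e3 | IsInducedPath.consecutive ip 2 k3
  ... | suc y | e = k3 , y , refl , drop-adj e2 refl e
  ... | zero  | _ with () ← IsInducedPath.injective ip 3 0 k3 z≤n (trans e3 (sym z0))
  two-after {q = q} {k} dom ip _ (suc i₀) zi e2 h
    with previous-of-new (q i₀) zi (IsInducedPath.consecutive ip i₀ (≤-trans (m≤n+m (suc i₀) 2) h))
  ... | c , ec , Cc =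
    ⊥-elim (not-near-3 (IsInducedPath.near ip (m+n≤o⇒n≤o 3 h) h (lift-adj ec e2 (adj-sym (dom Cc)))))

  -- A clash "w lies on P after z" puts w two steps after z: the successor of z is in C,
  -- hence adjacent to w.
  on-path-after : ∀ {w} → Dominating w → IsInducedPath H q k → q i ≡ zero → 3 ≤ k →
                  i < l → l ≤ k → q l ≡ suc w → AdjThreeAfter q k i w
  on-path-after {q = q} {k} {i} {l} {w} dom ip zi k3 i<l l≤k el
    with next-of-new (q (suc i)) zi (IsInducedPath.consecutive ip i (≤-trans i<l l≤k))
  ... | c , ec , Cc =
    two-after dom ip k3 i zi (subst (λ p → q p ≡ suc w) l≡2+i el) (subst (_≤ k) l≡2+i l≤k)
    where
    open IsInducedPath ip
    l≢1+i : suc i ≢ l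
    l≢1+i e = adjacent-distinct (dom Cc) (sym (suc-injective (trans (sym ec) (trans (cong q e) el))))
    l≡2+i : l ≡ 2 + i
    l≡2+i = ≤-antisym (proj₁ (near (≤-trans i<l l≤k) l≤k (lift-adj ec el (adj-sym (dom Cc)))))
                      (≤∧≢⇒< i<l l≢1+i)

  -- A clash "w adjacent to a far vertex x after z" puts x exactly three steps after z: the
  -- segment from the successor c of z to x avoids z, so its image is a shortest path of G,
  -- while c – w – x has length 2; and x two steps after z would close a triangle c, x, w.
  far-after : ∀ {w x} → Dominating w → IsInducedPath H q k → q i ≡ zero →
              i < l → l ≤ k → q l ≡ suc x → adj G w x ≡ true → ¬ Near i l → AdjThreeAfter q k i w
  far-after {q = q} {k} {i} {l} {w} {x} dom ip zi i<l l≤k el wx far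
    with next-of-new (q (suc i)) zi (IsInducedPath.consecutive ip i (≤-trans i<l l≤k))
  ... | c , ec , Cc = subst (_≤ k) l≡3+i l≤k , x , trans (cong q (sym l≡3+i)) el , wx
    where
    open IsInducedPath ip
    2+i≤l : 2 + i ≤ l
    2+i≤l = ≰⇒> λ l≤1+i → far (l≤1+i , ≤-trans (<⇒≤ i<l) (n≤1+n l))
    len = l ∸ suc i
    len-end : len + suc i ≡ l
    len-end = m∸n+n≡m i<l
    segment : IsInducedPath G (project w ∘ shift q (suc i)) len
    segment = avoiding-induced dom (subpath-induced ip (subst (_≤ k) (sym len-end) l≤k))
      λ j hj zj → <⇒≢ (m≤n+m (suc i) j)
        (sym (injective _ i (≤-trans (+-monoˡ-≤ (suc i) hj) (subst (_≤ k) (sym len-end) l≤k))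
                            (≤-trans (<⇒≤ i<l) l≤k) (trans zj (sym zi))))
    via-w : Walk G allV (project w (q (suc i))) (project w (q (len + suc i))) 2
    via-w = subst₂ (λ a b → Walk G allV (project w a) (project w b) 2)
                   (sym ec) (sym (trans (cong q len-end) el)) (two-step (adj-sym (dom Cc)) wx)
    l≤3+i : l ≤ 3 + i
    l≤3+i = subst (_≤ 3 + i) len-end (+-monoˡ-≤ (suc i) (geodesic G segment dh via-w))
    l≢2+i : 2 + i ≢ l
    l≢2+i e = no-triangle pc cx (adj-sym wx) (adj-sym (dom Cc))
      where
      cx : adj G c x ≡ true
      cx = drop-adj ec (trans (cong q e) el) (consecutive (suc i) (subst (_≤ k) (sym e) l≤k))
    l≡3+i : l ≡ 3 + i
    l≡3+i = ≤-antisym l≤3+i (≤∧≢⇒< 2+i≤l l≢2+i)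

  clash-after : ∀ {w} → Dominating w → IsInducedPath H q k → q i ≡ zero → 3 ≤ k →
                i < l → l ≤ k → Clash w i l (q l) → AdjThreeAfter q k i w
  clash-after {q = q} {k} {i} {l} {w} dom ip zi k3 i<l l≤k = by-kind (q l) refl
    where
    by-kind : ∀ y → q l ≡ y → Clash w i l y → AdjThreeAfter q k i w
    by-kind (suc x) el (inj₁ refl)        = on-path-after dom ip zi k3 i<l l≤k el
    by-kind (suc x) el (inj₂ (wx , far)) = far-after dom ip zi i<l l≤k el wx far

  -- If common neighbours of w and w' lie in C, they are not both adjacent to the vertex three
  -- steps after z: that vertex would lie in C, hence be adjacent to z.
  no-common-three-after : ∀ {w w'} → Joint w w' → IsInducedPath H q k → q i ≡ zero →
                          AdjThreeAfter q k i w → AdjThreeAfter q k i w' → ⊥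
  no-common-three-after {i = i} joint ip zi (h , x , ex , wx) (_ , x′ , ex′ , w'x′)
    with suc-injective (trans (sym ex) ex′)
  ... | refl = not-near-3 (common-near-new ip (m+n≤o⇒n≤o 3 h) h zi ex (joint wx w'x′))

  -- Let c, z, d, b, x be consecutive on P with x adjacent to w'.  Collapsing z
  -- onto w gives c – w – d – b – x, an induced path of length 4 in G, yet c – w' – x has
  -- length 2.  (Collapsing cannot clash here: a clash after z would make x a common
  -- neighbour of w and w', and c is adjacent to w.)
  no-domino : ∀ {w w'} → Dominating w → Dominating w' → Joint w w' → IsInducedPath H q k →
              q i ≡ zero → 0 < i → AdjThreeAfter q k i w' → ⊥
  no-domino {q = q} {k} {suc i₀} {w} {w'} dom dom' joint ip zi _ (h , x , ex , w'x)
    with previous-of-new (q i₀) zi (IsInducedPath.consecutive ip i₀ (m+n≤o⇒n≤o 3 h))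
  ... | c , ec , Cc = by-collapse (clash-or-induced dom sub-ip (s≤s z≤n) zi)
    where
    sub-ip : IsInducedPath H (shift q i₀) 4
    sub-ip = subpath-induced ip h
    by-collapse : (∃ λ l → l ≤ 4 × Clash w 1 l (shift q i₀ l)) ⊎ IsInducedPath G (project w ∘ shift q i₀) 4 → ⊥
    by-collapse (inj₂ collapsed) = 1+n≰n (≤-trans (n≤1+n 3) (geodesic G collapsed dh c-w'-x))
      where
      c-w'-x : Walk G allV (project w (q i₀)) (project w (q (4 + i₀))) 2
      c-w'-x = subst₂ (λ a b → Walk G allV (project w a) (project w b) 2) (sym ec) (sym ex)
                      (two-step (adj-sym (dom' Cc)) w'x)
    by-collapse (inj₁ (l , l≤4 , cl)) with <-cmp 1 l
    ... | tri< 1<l _ _ = no-common-three-after joint sub-ip zi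
                           (clash-after dom sub-ip zi (n≤1+n 3) 1<l l≤4 cl) (≤-refl , x , ex , w'x)
    ... | tri≈ _ refl _ = no-clash-at-new zi cl
    ... | tri> _ _ (s≤s z≤n) with subst (Clash w 1 0) ec cl
    ...   | inj₁ refl      = adjacent-distinct (dom Cc) refl
    ...   | inj₂ (_ , far) = far (z≤n , s≤s z≤n)

  -- Where a clash of w leaves its trace: w is adjacent to the vertex three steps after z,
  -- or three steps before it (three steps after z on the reversed path).
  Side : (ℕ → Fin (suc n)) → ℕ → ℕ → Fin n → Set
  Side q k i w = AdjThreeAfter q k i w ⊎ AdjThreeAfter (reverse q k) k (k ∸ i) w

  -- A clash before z is a clash after z on the reversed path.
  clash-side : ∀ {w} → Dominating w → IsInducedPath H q k → i ≤ k → q i ≡ zero → 3 ≤ k →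
               l ≤ k → Clash w i l (q l) → Side q k i w
  clash-side {q = q} {k} {i} {l} {w} dom ip hi zi k3 hl cl with <-cmp i l
  ... | tri< i<l _ _ = inj₁ (clash-after dom ip zi k3 i<l hl cl)
  ... | tri≈ _ refl _ = ⊥-elim (no-clash-at-new zi cl)
  ... | tri> _ _ l<i = inj₂ (clash-after dom (reverse-induced ip) (trans (cong q (m∸[m∸n]≡n hi)) zi) k3
                               (∸-monoʳ-< l<i hi) (m∸n≤m k l)
                               (subst (Clash w (k ∸ i) (k ∸ l)) (cong q (sym (m∸[m∸n]≡n hl)))
                                      (clash-reindex (reverse-near hi hl) cl)))

  reversed-three-after-positive : 3 + (k ∸ i) ≤ k → 0 < i
  reversed-three-after-positive {k} {zero}  h = ⊥-elim (1+n≰n (≤-trans (m≤n+m (suc k) 2) h))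
  reversed-three-after-positive {k} {suc i} _ = s≤s z≤n

  both-clash-impossible : IsInducedPath H q k → i ≤ k → q i ≡ zero → Side q k i v → Side q k i v' → ⊥
  both-clash-impossible ip hi zi (inj₁ after) (inj₁ after′) =
    no-common-three-after joint-vv' ip zi after after′
  both-clash-impossible {q = q} ip hi zi (inj₂ before) (inj₂ before′) =
    no-common-three-after joint-vv' (reverse-induced ip) (trans (cong q (m∸[m∸n]≡n hi)) zi) before before′
  both-clash-impossible ip hi zi (inj₁ after) (inj₂ before′) =
    no-domino dominating-v' dominating-v joint-v'v ip zi (reversed-three-after-positive (proj₁ before′)) after
  both-clash-impossible ip hi zi (inj₂ before) (inj₁ after′) =
    no-domino dominating-v dominating-v' joint-vv' ip zi (reversed-three-after-positive (proj₁ before)) after′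

  induced-geodesic-H : IsInducedPath H q k → Walk H allV (q 0) (q k) m → k ≤ m
  induced-geodesic-H {q = q} {k} {m} ip wk with m ≤? 1 | k ≤? m
  ... | yes m≤1 | _       = short-walk-bound ip wk m≤1
  ... | no _    | yes k≤m = k≤m
  ... | no m≰1  | no k≰m  = long (≤-trans (s≤s (≰⇒> m≰1)) (≰⇒> k≰m))
    where
    collapse : ∀ {w} → Dominating w → IsInducedPath G (project w ∘ q) k → k ≤ m
    collapse dom collapsed = geodesic G collapsed dh (project-walk dom wk)
    long : 3 ≤ k → k ≤ m
    long k3 with new-vertex? q k
    ... | inj₂ avoids = collapse dominating-v (avoiding-induced dominating-v ip avoids)
    ... | inj₁ (i , hi , zi)
      with clash-or-induced dominating-v ip hi zi | clash-or-induced dominating-v' ip hi zi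
    ...   | inj₂ collapsed | _ = collapse dominating-v collapsed
    ...   | _ | inj₂ collapsed = collapse dominating-v' collapsed
    ...   | inj₁ (l , hl , cl) | inj₁ (l′ , hl′ , cl′) =
      ⊥-elim (both-clash-impossible ip hi zi (clash-side dominating-v ip hi zi k3 hl cl)
                                              (clash-side dominating-v' ip hi zi k3 hl′ cl′))

  extension-BDH : BDH H
  extension-BDH = (colour , colour-proper) , distance-hereditary-from-geodesics H induced-geodesic-H

theorem3 : ∀ {n} (G : Graph n) (c : Fin n → Bool) →
    ProperColouring G c → DistanceHereditary G →
    (v v' : Fin n) → BDH' (star G c v v')
theorem3 {n} G c pc dh v v' = by-colours (c v xor c v')
  where
  by-colours : (b : Bool) → BDH' (if b then (n , G) else (suc n , extend G v v'))
  by-colours true  = (c , pc) , dh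
  by-colours false = Extension.extension-BDH G c pc dh v v'
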